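{- Let $G=(V,E)$ be a graph. Then $\mathcal{D}(G;x)=\mathcal{P}(G;x)$ if and only if for every non-isolated vertex $u\in V$ there exists $v\in N(u)$ such that $N[v]\subseteq N[u]$.
   Context: Graphs are finite and simple; $n=|V|$. $N(v)$ is the set of neighbors of $v$ and $N[v]=N(v)\cup\{v\}$. For $S\subseteq V$: $S$ is a dominating set if every vertex is in $S$ or adjacent to a vertex of $S$; $S$ is a power dominating set if, after coloring $S$, coloring every neighbor of a vertex of $S$, and then repeatedly applying the forcing rule (a colored vertex with exactly one uncolored neighbor colors that neighbor) until no changes occur, all vertices are colored. $\mathcal{D}(G;x)=\sum_{i=1}^n d(G;i)x^i$ and $\mathcal{P}(G;x)=\sum_{i=1}^n p(G;i)x^i$, where $d(G;i)$ and $p(G;i)$ are the numbers of dominating sets and power dominating sets of $G$ of size $i$. -}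

module Defs where

open import Data.Nat using (ℕ; zero; suc; _≡ᵇ_)
open import Data.Bool using (Bool; true; false; _∧_; _∨_; not; if_then_else_)
open import Data.Fin using (Fin)
open import Data.Fin.Properties using (_≟_)
open import Data.Vec using (Vec; []; _∷_; lookup; tabulate)
open import Data.List using (List; []; _∷_; map; _++_; length; filterᵇ; allFin)
open import Data.Bool.ListAction using (any; all)
open import Data.Fin.Subset using (Subset; ∣_∣)
open import Relation.Binary.PropositionalEquality using (_≡_)
open import Relation.Nullary.Decidable using (⌊_⌋)

record Graph (n : ℕ) : Set where
  field
    adj   : Fin n → Fin n → Bool
    sym   : ∀ u v → adj u v ≡ adj v u
    irrefl : ∀ v → adj v v ≡ false
open Graph public

module _ {n : ℕ} (G : Graph n) where

  inClosedNbhd : Fin n → Fin n → Bool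
  inClosedNbhd v w = ⌊ w ≟ v ⌋ ∨ adj G v w

  isDominating : Subset n → Bool
  isDominating S = all (λ w → any (λ v → lookup S v ∧ inClosedNbhd v w) (allFin n)) (allFin n)

  closedNbhdOf : Subset n → Subset n
  closedNbhdOf S = tabulate (λ w → any (λ v → lookup S v ∧ inClosedNbhd v w) (allFin n))

  uncolouredNbrs : Subset n → Fin n → ℕ
  uncolouredNbrs C v = length (filterᵇ (λ w → adj G v w ∧ not (lookup C w)) (allFin n))

  forceStep : Subset n → Subset n
  forceStep C = tabulate (λ w → lookup C w ∨
    any (λ v → lookup C v ∧ adj G v w ∧ (uncolouredNbrs C v ≡ᵇ 1)) (allFin n))

  iterate : ℕ → Subset n → Subset n
  iterate zero    C = C
  iterate (suc k) C = iterate k (forceStep C)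

  -- the final colouring: each non-stationary round colours at least one new
  -- vertex, so n rounds reach the fixed point of the forcing process.
  powerClosure : Subset n → Subset n
  powerClosure S = iterate n (closedNbhdOf S)

  isPowerDominating : Subset n → Bool
  isPowerDominating S = all (λ w → lookup (powerClosure S) w) (allFin n)

allSubsets : (n : ℕ) → List (Subset n)
allSubsets zero    = [] ∷ []
allSubsets (suc n) = map (true ∷_) (allSubsets n) ++ map (false ∷_) (allSubsets n)

countOfSize : {n : ℕ} → (Subset n → Bool) → ℕ → ℕ
countOfSize {n} P i = length (filterᵇ (λ S → (∣ S ∣ ≡ᵇ i) ∧ P S) (allSubsets n))

d : {n : ℕ} → Graph n → ℕ → ℕ
d G = countOfSize (isDominating G)

p : {n : ℕ} → Graph n → ℕ → ℕ
p G = countOfSize (isPowerDominating G)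

module Submission where

-- Every dominating set is power dominating, so the two polynomials agree iff
-- every power dominating set is dominating.
--
-- (⇐) Zero forcing can never colour a *fort*: a set F of uncoloured vertices
-- such that every vertex outside F with a neighbour in F has two of them.
-- Under the neighbourhood condition, an undominated vertex w lies in a fort
-- of undominated vertices: {w} if w is isolated, and otherwise a pair of
-- adjacent closed twins a, b with N[a] = N[b] ⊆ N[w], found by descending
-- along the condition with strictly decreasing |N[·]|.  Hence a
-- non-dominating set is not power dominating.
--
-- (⇒) If u is non-isolated and no neighbour v has N[v] ⊆ N[u], the set
-- S = V ∖ N[u] dominates everything except u, and any neighbour of u then
-- forces u.  So S is power dominating but not dominating, and
-- p(G;|S|) > d(G;|S|).

open import Defs hiding (sym)
open import Data.Nat using (ℕ; zero; suc; _≤_; _<_; z≤n; s≤s; _≡ᵇ_)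
open import Data.Nat.Properties
  using ( ≤-refl; n≤1+n; ≤-trans; ≤-antisym; ≤-reflexive; m≤n⇒m≤1+n; <-irrefl; ≤-<-trans
        ; ≡⇒≡ᵇ; ≡ᵇ⇒≡)
open import Data.Nat.Induction using (<-wellFounded)
open import Induction.WellFounded using (Acc; acc)
open import Data.Bool using (Bool; true; false; T; not; _∧_; _∨_)
open import Data.Bool.Properties using (T-∧; T-∨; T-≡) renaming (_≟_ to _≟ᵇ_)
open import Data.Bool.ListAction using (any; all)
open import Data.Fin using (Fin)
open import Data.Fin.Properties using (_≟_; any?; toℕ<n)
open import Data.Fin.Subset using (Subset; ∣_∣)
open import Data.Fin.Subset.Properties using (∣p∣≤n; x∈p⇒∣p-x∣<∣p∣)
open import Data.List using (List; []; _∷_; length; filterᵇ; allFin; map; _++_)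
open import Data.List.Properties using (filter-some; filter-none; filter-accept)
open import Data.List.Membership.Propositional using (_∈_; lose)
open import Data.List.Membership.Propositional.Properties
  using (∈-allFin; ∈-++⁺ˡ; ∈-++⁺ʳ; ∈-map⁺)
open import Data.List.Relation.Unary.Any using (here; there; satisfied)
open import Data.List.Relation.Unary.Any.Properties using (any⁺; any⁻)
open import Data.List.Relation.Unary.All as All using (All)
open import Data.List.Relation.Unary.All.Properties using (all⁺; all⁻)
open import Data.List.Relation.Unary.Unique.Propositional using (Unique)
open import Data.List.Relation.Unary.Unique.Propositional.Properties using (allFin⁺)
open import Data.List.Relation.Unary.AllPairs using (_∷_)
open import Data.Vec using (lookup; tabulate; []; _∷_)
open import Data.Vec.Properties using (lookup∘tabulate; lookup⇒[]=)
open import Data.Product using (Σ; _×_; _,_; proj₂)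
import Data.Sum as Sum
open import Data.Sum using (_⊎_; inj₁; inj₂)
open import Data.Empty using (⊥-elim)
open import Function using (_∘_)
open import Function.Bundles using (_⇔_; mk⇔; Equivalence)
open import Relation.Nullary using (¬_; Dec; yes; no; contradiction)
import Relation.Nullary.Decidable as Dec
open import Relation.Nullary.Decidable
  using (_×-dec_; _⊎-dec_; ¬?; T?; decidable-stable; toWitness; fromWitness)
open import Relation.Binary.PropositionalEquality
  using (_≡_; _≢_; refl; sym; trans; cong; subst)

open Equivalence using (to; from)

module Counting {a} {A : Set a} where

  count : (A → Bool) → List A → ℕ
  count P xs = length (filterᵇ P xs)

  count-mono : (P Q : A → Bool) → (∀ x → T (P x) → T (Q x)) →
               ∀ xs → count P xs ≤ count Q xs
  count-mono P Q P⇒Q [] = z≤n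
  count-mono P Q P⇒Q (x ∷ xs) with P x | Q x | P⇒Q x
  ... | true  | true  | _    = s≤s (count-mono P Q P⇒Q xs)
  ... | true  | false | P⇒Qx = ⊥-elim (P⇒Qx _)
  ... | false | true  | _    = m≤n⇒m≤1+n (count-mono P Q P⇒Q xs)
  ... | false | false | _    = count-mono P Q P⇒Q xs

  count-strict : (P Q : A → Bool) → (∀ x → T (P x) → T (Q x)) →
                 ∀ {y} xs → y ∈ xs → T (Q y) → ¬ T (P y) → count P xs < count Q xs
  count-strict P Q P⇒Q (x ∷ xs) (here refl) Qx ¬Px with P x | Q x
  ... | true  | _     = ⊥-elim (¬Px _)
  ... | false | true  = s≤s (count-mono P Q P⇒Q xs)
  ... | false | false = ⊥-elim Qx
  count-strict P Q P⇒Q (x ∷ xs) (there y∈xs) Qy ¬Py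
    with ih ← count-strict P Q P⇒Q xs y∈xs Qy ¬Py | P x | Q x | P⇒Q x
  ... | true  | true  | _    = s≤s ih
  ... | true  | false | P⇒Qx = ⊥-elim (P⇒Qx _)
  ... | false | true  | _    = m≤n⇒m≤1+n ih
  ... | false | false | _    = ih

  count-pos : (P : A → Bool) → ∀ {y} xs → y ∈ xs → T (P y) → 1 ≤ count P xs
  count-pos P xs y∈xs Py = filter-some (T? ∘ P) (lose y∈xs Py)

  count-accept : (P : A → Bool) → ∀ {x} xs → T (P x) → count P (x ∷ xs) ≡ suc (count P xs)
  count-accept P xs Px = cong length (filter-accept (T? ∘ P) Px)

  count-∷ : (P : A → Bool) → ∀ x xs → count P xs ≤ count P (x ∷ xs)
  count-∷ P x xs with P x
  ... | true  = n≤1+n _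
  ... | false = ≤-refl

  count-two : (P : A → Bool) → ∀ {x y} xs → x ≢ y → x ∈ xs → y ∈ xs →
              T (P x) → T (P y) → 2 ≤ count P xs
  count-two P (z ∷ zs) x≢y (here refl) (here refl) _ _ = contradiction refl x≢y
  count-two P (z ∷ zs) x≢y (here refl) (there y∈zs) Pz Py =
    subst (2 ≤_) (sym (count-accept P zs Pz)) (s≤s (count-pos P zs y∈zs Py))
  count-two P (z ∷ zs) x≢y (there x∈zs) (here refl) Px Pz =
    subst (2 ≤_) (sym (count-accept P zs Pz)) (s≤s (count-pos P zs x∈zs Px))
  count-two P (z ∷ zs) x≢y (there x∈zs) (there y∈zs) Px Py =
    ≤-trans (count-two P zs x≢y x∈zs y∈zs Px Py) (count-∷ P z zs)

  count-atMostOne : (P : A → Bool) → (∀ x y → T (P x) → T (P y) → x ≡ y) →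
                    ∀ xs → Unique xs → count P xs ≤ 1
  count-atMostOne P same [] _ = z≤n
  count-atMostOne P same (x ∷ xs) (x∉xs ∷ unique) with P x in Px
  ... | false = count-atMostOne P same xs unique
  ... | true  = s≤s (≤-reflexive (cong length (filter-none (T? ∘ P) nonePass)))
    where
    nonePass : All (¬_ ∘ T ∘ P) xs
    nonePass = All.map (λ x≢y Py → x≢y (same _ _ (subst T (sym Px) _) Py)) x∉xs

open Counting

any-allFin : ∀ {n} (P : Fin n → Bool) → T (any P (allFin n)) ⇔ Σ (Fin n) (T ∘ P)
any-allFin {n} P = mk⇔ (satisfied ∘ any⁻ P (allFin n))
                       (λ (i , Pi) → any⁺ {xs = allFin n} P (lose (∈-allFin i) Pi))

all-allFin : ∀ {n} (P : Fin n → Bool) → T (all P (allFin n)) ⇔ (∀ i → T (P i))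
all-allFin {n} P = mk⇔ (λ h i → All.lookup (all⁺ P _ h) (∈-allFin i))
                   (λ h → all⁻ P {allFin n} (All.tabulate (λ {i} _ → h i)))

count-exactlyOne : ∀ {n} (P : Fin n → Bool) {u : Fin n} → T (P u) →
                   (∀ y → T (P y) → y ≡ u) → count P (allFin n) ≡ 1
count-exactlyOne {n} P Pu onlyU = ≤-antisym
  (count-atMostOne P (λ x y Px Py → trans (onlyU x Px) (sym (onlyU y Py)))
                     (allFin n) (allFin⁺ n))
  (count-pos P (allFin n) (∈-allFin _) Pu)

inclusion-or-witness : ∀ {n p q} {P : Fin n → Set p} {Q : Fin n → Set q} →
  (∀ i → Dec (P i)) → (∀ i → Dec (Q i)) →
  (∀ i → P i → Q i) ⊎ Σ (Fin n) (λ i → P i × ¬ Q i)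
inclusion-or-witness P? Q? with any? (λ i → P? i ×-dec ¬? (Q? i))
... | yes witness = inj₂ witness
... | no  none    = inj₁ λ i Pi → decidable-stable (Q? i) (λ ¬Qi → none (i , Pi , ¬Qi))

T-not : ∀ {b} → T (not b) ⇔ (¬ T b)
T-not {true}  = mk⇔ (λ ()) (λ ¬t → ¬t _)
T-not {false} = mk⇔ (λ _ ()) (λ _ → _)

∧-monoʳ : ∀ {a b c} → (T b → T c) → T (a ∧ b) → T (a ∧ c)
∧-monoʳ {true} b⇒c = b⇒c

Coloured : ∀ {n} → Subset n → Fin n → Set
Coloured C w = T (lookup C w)

coloured-tabulate : ∀ {n} (f : Fin n → Bool) {w} → Coloured (tabulate f) w ⇔ T (f w)
coloured-tabulate f {w} =
  mk⇔ (subst T (lookup∘tabulate f w)) (subst T (sym (lookup∘tabulate f w)))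

coloured⇒nonempty : ∀ {n} (S : Subset n) {x} → Coloured S x → 1 ≤ ∣ S ∣
coloured⇒nonempty S {x} Sx =
  ≤-trans (s≤s z≤n) (x∈p⇒∣p-x∣<∣p∣ (lookup⇒[]= x S (to T-≡ Sx)))

∈-allSubsets : ∀ {n} (S : Subset n) → S ∈ allSubsets n
∈-allSubsets [] = here refl
∈-allSubsets {suc n} (true ∷ S) = ∈-++⁺ˡ (∈-map⁺ (true ∷_) (∈-allSubsets S))
∈-allSubsets {suc n} (false ∷ S) =
  ∈-++⁺ʳ (map (true ∷_) (allSubsets n)) (∈-map⁺ (false ∷_) (∈-allSubsets S))

countOfSize-mono : ∀ {n} (P Q : Subset n → Bool) → (∀ S → T (P S) → T (Q S)) →
                   ∀ i → countOfSize P i ≤ countOfSize Q i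
countOfSize-mono {n} P Q P⇒Q i =
  count-mono _ _ (λ S → ∧-monoʳ {∣ S ∣ ≡ᵇ i} (P⇒Q S)) (allSubsets n)

countOfSize-strict : ∀ {n} (P Q : Subset n → Bool) → (∀ S → T (P S) → T (Q S)) →
  ∀ S → T (Q S) → ¬ T (P S) → countOfSize P ∣ S ∣ < countOfSize Q ∣ S ∣
countOfSize-strict {n} P Q P⇒Q S QS ¬PS =
  count-strict _ _ (λ R → ∧-monoʳ {∣ R ∣ ≡ᵇ ∣ S ∣} (P⇒Q R)) (allSubsets n) (∈-allSubsets S)
    (from T-∧ (≡⇒≡ᵇ ∣ S ∣ ∣ S ∣ refl , QS)) (¬PS ∘ proj₂ ∘ to T-∧)

module GraphFacts {n : ℕ} (G : Graph n) where

  infix 4 _∼_ _⊑_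

  _∼_ : Fin n → Fin n → Set
  u ∼ v = adj G u v ≡ true

  ∼-sym : ∀ {u v} → u ∼ v → v ∼ u
  ∼-sym {u} {v} u∼v = trans (Graph.sym G v u) u∼v

  ∼-irrefl : ∀ {u v} → u ∼ v → u ≢ v
  ∼-irrefl {u} u∼u refl with trans (sym u∼u) (irrefl G u)
  ... | ()

  NonIsolated : Fin n → Set
  NonIsolated u = Σ (Fin n) (u ∼_)

  nonIsolated? : ∀ u → Dec (NonIsolated u)
  nonIsolated? u = any? (λ v → adj G u v ≟ᵇ true)

  _∈N[_] : Fin n → Fin n → Set
  w ∈N[ v ] = w ≡ v ⊎ v ∼ w

  ∈N-self : ∀ {v} → v ∈N[ v ]
  ∈N-self = inj₁ refl

  ∈N-sym : ∀ {v w} → w ∈N[ v ] → v ∈N[ w ]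
  ∈N-sym (inj₁ refl) = inj₁ refl
  ∈N-sym (inj₂ v∼w)  = inj₂ (∼-sym v∼w)

  _∈N?[_] : ∀ w v → Dec (w ∈N[ v ])
  w ∈N?[ v ] = (w ≟ v) ⊎-dec (adj G v w ≟ᵇ true)

  inClosedNbhd⇔ : ∀ {v w} → T (inClosedNbhd G v w) ⇔ w ∈N[ v ]
  inClosedNbhd⇔ = mk⇔ (Sum.map toWitness (to T-≡) ∘ to T-∨)
                      (from T-∨ ∘ Sum.map fromWitness (from T-≡))

  _⊑_ : Fin n → Fin n → Set
  v ⊑ u = ∀ w → w ∈N[ v ] → w ∈N[ u ]

  ⊑-refl : ∀ {v} → v ⊑ v
  ⊑-refl _ w∈N = w∈N

  ⊑-trans : ∀ {u v w} → u ⊑ v → v ⊑ w → u ⊑ w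
  ⊑-trans u⊑v v⊑w x = v⊑w x ∘ u⊑v x

  ⊑-or-witness : ∀ v u → v ⊑ u ⊎ Σ (Fin n) (λ w → w ∈N[ v ] × ¬ w ∈N[ u ])
  ⊑-or-witness v u = inclusion-or-witness (_∈N?[ v ]) (_∈N?[ u ])

  _⊑?_ : ∀ v u → Dec (v ⊑ u)
  v ⊑? u with ⊑-or-witness v u
  ... | inj₁ v⊑u            = yes v⊑u
  ... | inj₂ (w , w∈v , w∉u) = no λ v⊑u → w∉u (v⊑u w w∈v)

  closedDegree : Fin n → ℕ
  closedDegree v = count (inClosedNbhd G v) (allFin n)

  ⊑-closedDegree< : ∀ {v u w} → v ⊑ u → w ∈N[ u ] → ¬ w ∈N[ v ] →
                    closedDegree v < closedDegree u
  ⊑-closedDegree< {w = w} v⊑u w∈u w∉v =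
    count-strict _ _ (λ x → from inClosedNbhd⇔ ∘ v⊑u x ∘ to inClosedNbhd⇔)
      (allFin n) (∈-allFin w) (from inClosedNbhd⇔ w∈u) (w∉v ∘ to inClosedNbhd⇔)

  Condition : Set
  Condition = ∀ u → NonIsolated u → Σ (Fin n) (λ v → u ∼ v × v ⊑ u)

  ClosedTwins : Fin n → Fin n → Set
  ClosedTwins a b = a ∼ b × a ⊑ b × b ⊑ a

  -- Under the condition, below every non-isolated vertex w sit adjacent
  -- closed twins a, b with N[a] ⊆ N[w]: follow the condition from w to a
  -- neighbour x with N[x] ⊆ N[w]; stop if N[w] ⊆ N[x], else |N[x]| < |N[w]|.
  twins-below : Condition → ∀ w → NonIsolated w →
                Σ (Fin n) λ a → Σ (Fin n) λ b → ClosedTwins a b × a ⊑ w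
  twins-below cond w nw = descend w nw (<-wellFounded (closedDegree w))
    where
    descend : ∀ w → NonIsolated w → Acc _<_ (closedDegree w) →
              Σ (Fin n) λ a → Σ (Fin n) λ b → ClosedTwins a b × a ⊑ w
    descend w nw (acc smaller) with cond w nw
    ... | x , w∼x , x⊑w with ⊑-or-witness w x
    ...   | inj₁ w⊑x = w , x , (w∼x , w⊑x , x⊑w) , ⊑-refl
    ...   | inj₂ (y , y∈w , y∉x) with descend x (w , ∼-sym w∼x)
                                            (smaller (⊑-closedDegree< x⊑w y∈w y∉x))
    ...     | a , b , twins , a⊑x = a , b , twins , ⊑-trans a⊑x x⊑w

  Dominated : Subset n → Fin n → Set
  Dominated S w = Σ (Fin n) λ v → Coloured S v × w ∈N[ v ]

  dominatedᵇ : Subset n → Fin n → Bool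
  dominatedᵇ S w = any (λ v → lookup S v ∧ inClosedNbhd G v w) (allFin n)

  dominated⇔ : ∀ S {w} → T (dominatedᵇ S w) ⇔ Dominated S w
  dominated⇔ S = mk⇔
    (λ t → let v , Sv∧v∈ = to (any-allFin _) t
               Sv , v∈ = to T-∧ Sv∧v∈
           in v , Sv , to inClosedNbhd⇔ v∈)
    (λ (v , Sv , w∈v) → from (any-allFin _) (v , from T-∧ (Sv , from inClosedNbhd⇔ w∈v)))

  closedNbhdOf⇔ : ∀ S {w} → Coloured (closedNbhdOf G S) w ⇔ Dominated S w
  closedNbhdOf⇔ S = mk⇔ (to (dominated⇔ S) ∘ to (coloured-tabulate (dominatedᵇ S)))
                          (from (coloured-tabulate (dominatedᵇ S)) ∘ from (dominated⇔ S))

  dominated? : ∀ S w → Dec (Dominated S w)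
  dominated? S w = Dec.map (closedNbhdOf⇔ S {w}) (T? _)

  isDominating⇔ : ∀ S → T (isDominating G S) ⇔ (∀ w → Dominated S w)
  isDominating⇔ S = mk⇔ (λ t w → to (dominated⇔ S) (to (all-allFin _) t w))
                          (λ h → from (all-allFin _) (from (dominated⇔ S) ∘ h))

  isPowerDominating⇔ : ∀ S → T (isPowerDominating G S) ⇔
                               (∀ w → Coloured (powerClosure G S) w)
  isPowerDominating⇔ S = all-allFin _

  undominated-⊑ : ∀ S {x w} → x ⊑ w → ¬ Dominated S w → ¬ Dominated S x
  undominated-⊑ S x⊑w ¬Dw (v , Sv , x∈v) =
    ¬Dw (v , Sv , ∈N-sym (x⊑w v (∈N-sym x∈v)))

  uncolouredNbr⇔ : ∀ C {v w} → T (adj G v w ∧ not (lookup C w)) ⇔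
                               (v ∼ w × ¬ Coloured C w)
  uncolouredNbr⇔ C = mk⇔
    (λ t → let v∼w , ¬Cw = to T-∧ t in to T-≡ v∼w , to T-not ¬Cw)
    (λ (v∼w , ¬Cw) → from T-∧ (from T-≡ v∼w , from T-not ¬Cw))

  Forces : Subset n → Fin n → Fin n → Set
  Forces C v w = Coloured C v × v ∼ w × uncolouredNbrs G C v ≡ 1

  forcesᵇ : Subset n → Fin n → Fin n → Bool
  forcesᵇ C v w = lookup C v ∧ adj G v w ∧ (uncolouredNbrs G C v ≡ᵇ 1)

  forces⇔ : ∀ C {v w} → T (forcesᵇ C v w) ⇔ Forces C v w
  forces⇔ C = mk⇔
    (λ t → let Cv , rest = to T-∧ t
               v∼w , one = to T-∧ rest
           in Cv , to T-≡ v∼w , ≡ᵇ⇒≡ _ 1 one)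
    (λ (Cv , v∼w , one) → from T-∧ (Cv , from T-∧ (from T-≡ v∼w , ≡⇒≡ᵇ _ 1 one)))

  forceStep⇔ : ∀ C {w} → Coloured (forceStep G C) w ⇔
                         (Coloured C w ⊎ Σ (Fin n) λ v → Forces C v w)
  forceStep⇔ C {w} = mk⇔
    (Sum.map₂ forced⇒ ∘ to T-∨ ∘ to (coloured-tabulate step))
    (from (coloured-tabulate step) ∘ from T-∨ ∘ Sum.map₂ ⇒forced)
    where
    step : Fin n → Bool
    step x = lookup C x ∨ any (λ v → forcesᵇ C v x) (allFin n)
    forced⇒ : T (any (λ v → forcesᵇ C v w) (allFin n)) → Σ (Fin n) λ v → Forces C v w
    forced⇒ t = let v , f = to (any-allFin _) t in v , to (forces⇔ C) f
    ⇒forced : (Σ (Fin n) λ v → Forces C v w) → T (any (λ v → forcesᵇ C v w) (allFin n))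
    ⇒forced (v , f) = from (any-allFin _) (v , from (forces⇔ C) f)

  forceStep-inflationary : ∀ C {w} → Coloured C w → Coloured (forceStep G C) w
  forceStep-inflationary C = from (forceStep⇔ C) ∘ inj₁

  iterate-inflationary : ∀ k C {w} → Coloured C w → Coloured (iterate G k C) w
  iterate-inflationary zero    C Cw = Cw
  iterate-inflationary (suc k) C Cw =
    iterate-inflationary k (forceStep G C) (forceStep-inflationary C Cw)

  iterate-after-step : ∀ k C {w} → 0 < k → Coloured (forceStep G C) w →
                       Coloured (iterate G k C) w
  iterate-after-step (suc k) C _ Cw = iterate-inflationary k (forceStep G C) Cw

  Fort : (Fin n → Set) → Set
  Fort X = ∀ {v x} → ¬ X v → X x → v ∼ x → Σ (Fin n) λ y → X y × y ≢ x × v ∼ y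

  Uncoloured : (Fin n → Set) → Subset n → Set
  Uncoloured X C = ∀ {x} → X x → ¬ Coloured C x

  -- no vertex of an uncoloured fort can be forced: a coloured neighbour of
  -- it lies outside the fort and so sees two uncoloured neighbours
  fort-survives-step : ∀ {X} → Fort X → ∀ C → Uncoloured X C → Uncoloured X (forceStep G C)
  fort-survives-step fort C unc {x} Xx Cx with to (forceStep⇔ C) Cx
  ... | inj₁ Cx′ = unc Xx Cx′
  ... | inj₂ (v , Cv , v∼x , one) with fort (λ Xv → unc Xv Cv) Xx v∼x
  ...   | y , Xy , y≢x , v∼y = <-irrefl refl (subst (2 ≤_) one two)
    where
    two : 2 ≤ uncolouredNbrs G C v
    two = count-two _ (allFin n) (y≢x ∘ sym) (∈-allFin x) (∈-allFin y)
            (from (uncolouredNbr⇔ C) (v∼x , unc Xx)) (from (uncolouredNbr⇔ C) (v∼y , unc Xy))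

  fort-survives : ∀ {X} → Fort X → ∀ k C → Uncoloured X C → Uncoloured X (iterate G k C)
  fort-survives fort zero    C unc = unc
  fort-survives fort (suc k) C unc =
    fort-survives fort k (forceStep G C) (fort-survives-step fort C unc)

  isolated-fort : ∀ {w} → (∀ v → ¬ w ∼ v) → Fort (_≡ w)
  isolated-fort isolated {v} _ refl v∼w = ⊥-elim (isolated v (∼-sym v∼w))

  ⊑-shares-neighbour : ∀ {x y v} → x ⊑ y → v ≢ y → v ∼ x → v ∼ y
  ⊑-shares-neighbour x⊑y v≢y v∼x with x⊑y _ (inj₂ (∼-sym v∼x))
  ... | inj₁ v≡y = contradiction v≡y v≢y
  ... | inj₂ y∼v = ∼-sym y∼v

  twins-fort : ∀ {a b} → ClosedTwins a b → Fort (λ x → x ≡ a ⊎ x ≡ b)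
  twins-fort (a∼b , a⊑b , b⊑a) v∉X (inj₁ refl) v∼a =
    _ , inj₂ refl , ∼-irrefl a∼b ∘ sym , ⊑-shares-neighbour a⊑b (v∉X ∘ inj₂) v∼a
  twins-fort (a∼b , a⊑b , b⊑a) v∉X (inj₂ refl) v∼b =
    _ , inj₁ refl , ∼-irrefl a∼b , ⊑-shares-neighbour b⊑a (v∉X ∘ inj₁) v∼b

  dominating⇒powerDominating : ∀ S → T (isDominating G S) → T (isPowerDominating G S)
  dominating⇒powerDominating S dom = from (isPowerDominating⇔ S) λ w →
    iterate-inflationary n (closedNbhdOf G S)
      (from (closedNbhdOf⇔ S) (to (isDominating⇔ S) dom w))

  fort-never-coloured : ∀ {X} S → Fort X → (∀ {x} → X x → ¬ Dominated S x) →
                        Uncoloured X (powerClosure G S)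
  fort-never-coloured S fort undom =
    fort-survives fort n (closedNbhdOf G S) (λ Xx → undom Xx ∘ to (closedNbhdOf⇔ S))

  -- Under the condition an undominated vertex lies in a fort of undominated
  -- vertices: itself if isolated, otherwise the closed twins below it.
  undominated⇒never-coloured : Condition → ∀ S {w} → ¬ Dominated S w →
                               Σ (Fin n) λ x → ¬ Coloured (powerClosure G S) x
  undominated⇒never-coloured cond S {w} ¬Dw with nonIsolated? w
  ... | no isolated =
    w , fort-never-coloured S (isolated-fort λ v w∼v → isolated (v , w∼v)) (λ { refl → ¬Dw }) refl
  ... | yes nw with twins-below cond w nw
  ...   | a , b , twins@(_ , _ , b⊑a) , a⊑w =
    a , fort-never-coloured S (twins-fort twins) undominated (inj₁ refl)
    where
    undominated : ∀ {x} → x ≡ a ⊎ x ≡ b → ¬ Dominated S x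
    undominated (inj₁ refl) = undominated-⊑ S a⊑w ¬Dw
    undominated (inj₂ refl) = undominated-⊑ S (⊑-trans b⊑a a⊑w) ¬Dw

  powerDominating⇒dominating : Condition → ∀ S → T (isPowerDominating G S) → T (isDominating G S)
  powerDominating⇒dominating cond S pd = from (isDominating⇔ S) λ w →
    decidable-stable (dominated? S w) λ ¬Dw →
      let x , never = undominated⇒never-coloured cond S ¬Dw
      in never (to (isPowerDominating⇔ S) pd x)

  condition⇒d≡p : Condition → ∀ i → 1 ≤ i → i ≤ n → d G i ≡ p G i
  condition⇒d≡p cond i _ _ = ≤-antisym
    (countOfSize-mono _ _ dominating⇒powerDominating i)
    (countOfSize-mono _ _ (powerDominating⇒dominating cond) i)

  outside : Fin n → Subset n
  outside u = tabulate (not ∘ inClosedNbhd G u)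

  outside⇔ : ∀ u {w} → Coloured (outside u) w ⇔ (¬ w ∈N[ u ])
  outside⇔ u = mk⇔
    (λ c → to T-not (to (coloured-tabulate outsideᵇ) c) ∘ from inClosedNbhd⇔)
    (λ w∉u → from (coloured-tabulate outsideᵇ) (from T-not (w∉u ∘ to inClosedNbhd⇔)))
    where
    outsideᵇ : Fin n → Bool
    outsideᵇ = not ∘ inClosedNbhd G u

  outside-undominated : ∀ u → ¬ Dominated (outside u) u
  outside-undominated u (v , Sv , u∈v) = to (outside⇔ u) Sv (∈N-sym u∈v)

  -- if no neighbour v of u has N[v] ⊆ N[u], then V ∖ N[u] dominates every
  -- w ≠ u: a neighbour w of u has some y ∈ N[w] ∖ N[u]
  outside-dominates-others : ∀ {u} → (∀ v → u ∼ v → ¬ v ⊑ u) →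
                             ∀ {w} → w ≢ u → Dominated (outside u) w
  outside-dominates-others {u} noSub {w} w≢u with w ∈N?[ u ]
  ... | no w∉u         = w , from (outside⇔ u) w∉u , ∈N-self
  ... | yes (inj₁ w≡u) = contradiction w≡u w≢u
  ... | yes (inj₂ u∼w) with ⊑-or-witness w u
  ...   | inj₁ w⊑u             = contradiction w⊑u (noSub w u∼w)
  ...   | inj₂ (y , y∈w , y∉u) = y , from (outside⇔ u) y∉u , ∈N-sym y∈w

  -- if every vertex but a non-isolated u is coloured, any neighbour of u
  -- forces it, so one step colours everything
  forceStep-completes : ∀ C {u} → (∀ {w} → w ≢ u → Coloured C w) → NonIsolated u →
                        ∀ w → Coloured (forceStep G C) w
  forceStep-completes C {u} others (v , u∼v) w with w ≟ u
  ... | no w≢u = forceStep-inflationary C (others w≢u)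
  ... | yes refl with T? (lookup C u)
  ...   | yes Cu  = forceStep-inflationary C Cu
  ...   | no  ¬Cu =
    from (forceStep⇔ C) (inj₂ (v , others (∼-irrefl u∼v ∘ sym) , ∼-sym u∼v , onlyU))
    where
    onlyU : uncolouredNbrs G C v ≡ 1
    onlyU = count-exactlyOne _ (from (uncolouredNbr⇔ C) (∼-sym u∼v , ¬Cu))
              (λ y t → decidable-stable (y ≟ u) (proj₂ (to (uncolouredNbr⇔ C) t) ∘ others))

  outside-powerDominating : ∀ {u} → NonIsolated u → (∀ v → u ∼ v → ¬ v ⊑ u) →
                            T (isPowerDominating G (outside u))
  outside-powerDominating {u} nu noSub = from (isPowerDominating⇔ (outside u)) λ w →
    iterate-after-step n C₀ (≤-<-trans z≤n (toℕ<n w)) (forceStep-completes C₀ othersColoured nu w)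
    where
    C₀ : Subset n
    C₀ = closedNbhdOf G (outside u)
    othersColoured : ∀ {w} → w ≢ u → Coloured C₀ w
    othersColoured = from (closedNbhdOf⇔ (outside u)) ∘ outside-dominates-others noSub

  -- if the condition fails at u, then V ∖ N[u] is power dominating but not
  -- dominating, so p(G;|V ∖ N[u]|) > d(G;|V ∖ N[u]|)
  d≡p⇒condition : (∀ i → 1 ≤ i → i ≤ n → d G i ≡ p G i) → Condition
  d≡p⇒condition d≡p u nu with any? (λ v → (adj G u v ≟ᵇ true) ×-dec (v ⊑? u))
  ... | yes found = found
  ... | no  none  = ⊥-elim (<-irrefl (d≡p ∣ S ∣ nonempty (∣p∣≤n S))
                      (countOfSize-strict _ _ dominating⇒powerDominating S
                        (outside-powerDominating nu noSub) notDominating))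
    where
    S : Subset n
    S = outside u
    noSub : ∀ v → u ∼ v → ¬ v ⊑ u
    noSub v u∼v v⊑u = none (v , u∼v , v⊑u)
    notDominating : ¬ T (isDominating G S)
    notDominating dom = outside-undominated u (to (isDominating⇔ S) dom u)
    nonempty : 1 ≤ ∣ S ∣
    nonempty with outside-dominates-others noSub (∼-irrefl (proj₂ nu) ∘ sym)
    ... | _ , Sy , _ = coloured⇒nonempty S Sy

theorem13 : (n : ℕ) (G : Graph n) →
    ((i : ℕ) → 1 ≤ i → i ≤ n → d G i ≡ p G i)
    ⇔
    ((u : Fin n) → Σ (Fin n) (λ w → adj G u w ≡ true) →
      Σ (Fin n) (λ v → adj G u v ≡ true ×
        ((w : Fin n) → (w ≡ v ⊎ adj G v w ≡ true) → (w ≡ u ⊎ adj G u w ≡ true))))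
theorem13 n G = mk⇔ d≡p⇒condition condition⇒d≡p
  where open GraphFacts G
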